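{- Let $n = p_1^{k_1} p_2^{k_2} \cdots p_r^{k_r}$ be the prime factorization of a positive integer $n$, with distinct primes $p_i$ and integers $k_i \ge 1$, and let $D = \prod_{i=1}^r (k_i+1)$ be the number of divisors of $n$. Then the Wiener index of the divisor prime graph $G_{Dp(n)}$ is $$W(G_{Dp(n)}) = D(D-1) - \frac{1}{2}\left( \prod_{i=1}^r (2k_i + 1) - 1 \right).$$
   Context: For a positive integer $n$, the divisor prime graph $G_{Dp(n)}$ is the simple graph whose vertex set is the set of positive divisors of $n$, in which two distinct vertices $x, y$ are adjacent if and only if $\gcd(x,y) = 1$ (no loops). For a connected graph $G$, $d(u,v)$ denotes the shortest-path distance, and the Wiener index is $W(G) = \sum_{\{u,v\}} d(u,v)$, the sum over all unordered pairs of distinct vertices. -}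

module Defs where

open import Data.Nat using (ℕ; zero; suc; _+_; _*_; _≤_; _<_)
open import Data.Nat.Divisibility using (_∣_; _∣?_)
open import Data.Nat.GCD using (gcd)
open import Data.List using (List; []; _∷_; map; filter; upTo)
open import Data.Nat.ListAction using (sum)
open import Data.Product using (_×_)
open import Relation.Binary.PropositionalEquality using (_≡_; _≢_)

divisors : ℕ → List ℕ
divisors n = filter (_∣? n) (map suc (upTo n))

Vertex : ℕ → ℕ → Set
Vertex n x = (0 < x) × (x ∣ n)

Adj : ℕ → ℕ → ℕ → Set
Adj n x y = Vertex n x × Vertex n y × (x ≢ y) × (gcd x y ≡ 1)

data Walk (n : ℕ) : ℕ → ℕ → ℕ → Set where
  nil  : ∀ {x} → Vertex n x → Walk n x x 0
  cons : ∀ {x z y ℓ} → Adj n x z → Walk n z y ℓ → Walk n x y (suc ℓ)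

IsDist : ℕ → ℕ → ℕ → ℕ → Set
IsDist n x y d = Walk n x y d × (∀ ℓ → Walk n x y ℓ → d ≤ ℓ)

pairSum : (ℕ → ℕ → ℕ) → List ℕ → ℕ
pairSum d [] = 0
pairSum d (x ∷ xs) = sum (map (d x) xs) + pairSum d xs

wiener : ℕ → (ℕ → ℕ → ℕ) → ℕ
wiener n d = pairSum d (divisors n)

{-# OPTIONS --safe #-}
module Submission where

-- Any two divisors of n are joined through the vertex 1, so distinct vertices x, y are at
-- distance 1 if gcd(x, y) = 1 and at distance 2 otherwise. Hence W = D(D - 1) - P, where P
-- is the number of unordered pairs of distinct coprime divisors. The number C of ordered
-- pairs (x, y) of divisors with gcd(x, y) = 1 equals 2P + 1, since (1, 1) is the only such
-- pair on the diagonal. Finally C is multiplicative over coprime factors of n, and for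
-- n = p^k it is 2k + 1 because one entry of a coprime pair of powers of p must be 1.

open import Defs
open import Data.Bool using (if_then_else_)
open import Data.Empty using (⊥-elim)
open import Data.List using (List; []; _∷_; map; _++_; length; upTo; cartesianProductWith)
open import Data.List.Membership.Propositional using (_∈_)
open import Data.List.Membership.Propositional.Properties
  using (∈-map⁺; ∈-map⁻; ∈-filter⁺; ∈-filter⁻; ∈-upTo⁺; ∈-cartesianProductWith⁺; ∈-cartesianProductWith⁻)
open import Data.List.Membership.Propositional.Properties.WithK using (unique∧set⇒bag)
open import Data.List.Properties using (length-map; length-++; map-++; map-∘)
open import Data.List.Relation.Binary.BagAndSetEquality using (∼bag⇒↭)
open import Data.List.Relation.Binary.Permutation.Propositional using (_↭_)
open import Data.List.Relation.Binary.Permutation.Propositional.Properties using (↭-length)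
import Data.List.Relation.Binary.Permutation.Propositional.Properties as ↭
open import Data.List.Relation.Unary.All as All using (All; []; _∷_)
import Data.List.Relation.Unary.All.Properties as All
open import Data.List.Relation.Unary.Any using (here; there)
open import Data.List.Relation.Unary.AllPairs using ([]; _∷_)
open import Data.List.Relation.Unary.Unique.Propositional using (Unique)
import Data.List.Relation.Unary.Unique.Propositional.Properties as Unique
open import Data.Nat using (ℕ; zero; suc; _+_; _*_; _∸_; _≤_; _^_; z≤n; s≤s; _≟_; NonZero; nonTrivial⇒≢1; ≢-nonZero⁻¹)
open import Data.Nat.Coprimality using (Coprime; coprime?; coprime-divisor; 1-coprimeTo; coprime⇒gcd≡1; gcd≡1⇒coprime)
import Data.Nat.Coprimality as Coprimality
open import Data.Nat.Divisibility
open import Data.Nat.DivMod using (_/_; m*n/n≡m)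
open import Data.Nat.GCD using (gcd; gcd[m,n]∣m; gcd[m,n]∣n; gcd-greatest; gcd-zeroˡ; gcd-zeroʳ; c*gcd[m,n]≡gcd[cm,cn])
open import Data.Nat.ListAction using (sum; product)
open import Data.Nat.ListAction.Properties using (sum-++; sum-↭; product≢0)
open import Data.Nat.Primality using (Prime; prime⇒nonZero; prime⇒nonTrivial; prime⇒irreducible; euclidsLemma)
open import Data.Nat.Properties
open import Algebra.Properties.CommutativeSemigroup +-commutativeSemigroup using (interchange)
open import Data.Nat.Tactic.RingSolver using (solve-∀)
open import Data.Product using (Σ; _×_; _,_; proj₁; proj₂)
open import Data.Sum using (inj₁; inj₂)
open import Function using (_∘_; _⇔_; mk⇔; Equivalence)
open import Relation.Nullary using (¬_; Dec; yes; no; does; contradiction; _×-dec_)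
open import Relation.Binary.PropositionalEquality

private
  variable
    a b n p : ℕ
    xs ys : List ℕ

-- Sums over lists

∑ : List ℕ → (ℕ → ℕ) → ℕ
∑ xs f = sum (map f xs)

syntax ∑ xs (λ x → e) = ∑[ x ∈ xs ] e

∑-cong : ∀ xs {f g : ℕ → ℕ} → (∀ {x} → x ∈ xs → f x ≡ g x) → ∑ xs f ≡ ∑ xs g
∑-cong []       _  = refl
∑-cong (x ∷ xs) eq = cong₂ _+_ (eq (here refl)) (∑-cong xs (eq ∘ there))

∑-zero : ∀ xs {f : ℕ → ℕ} → (∀ {x} → x ∈ xs → f x ≡ 0) → ∑ xs f ≡ 0
∑-zero []       _  = refl
∑-zero (x ∷ xs) eq = cong₂ _+_ (eq (here refl)) (∑-zero xs (eq ∘ there))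

∑-const : ∀ xs c → ∑[ _ ∈ xs ] c ≡ length xs * c
∑-const []       c = refl
∑-const (x ∷ xs) c = cong (c +_) (∑-const xs c)

∑-+ : ∀ xs (f g : ℕ → ℕ) → ∑[ x ∈ xs ] (f x + g x) ≡ ∑ xs f + ∑ xs g
∑-+ []       f g = refl
∑-+ (x ∷ xs) f g = trans (cong (f x + g x +_) (∑-+ xs f g)) (interchange (f x) (g x) (∑ xs f) (∑ xs g))

∑-*ˡ : ∀ xs c (f : ℕ → ℕ) → ∑[ x ∈ xs ] (c * f x) ≡ c * ∑ xs f
∑-*ˡ []       c f = sym (*-zeroʳ c)
∑-*ˡ (x ∷ xs) c f = trans (cong (c * f x +_) (∑-*ˡ xs c f)) (sym (*-distribˡ-+ c (f x) (∑ xs f)))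

∑-*ʳ : ∀ xs c (f : ℕ → ℕ) → ∑[ x ∈ xs ] (f x * c) ≡ ∑ xs f * c
∑-*ʳ []       c f = refl
∑-*ʳ (x ∷ xs) c f = trans (cong (f x * c +_) (∑-*ʳ xs c f)) (sym (*-distribʳ-+ c (f x) (∑ xs f)))

∑∑-separable : ∀ xs ys (f g : ℕ → ℕ) → ∑[ x ∈ xs ] ∑[ y ∈ ys ] (f x * g y) ≡ ∑ xs f * ∑ ys g
∑∑-separable xs ys f g = trans (∑-cong xs (λ {x} _ → ∑-*ˡ ys (f x) g)) (∑-*ʳ xs (∑ ys g) f)

∑-map : ∀ (g : ℕ → ℕ) xs f → ∑ (map g xs) f ≡ ∑[ x ∈ xs ] f (g x)
∑-map g xs f = cong sum (sym (map-∘ xs))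

∑-++ : ∀ xs ys (f : ℕ → ℕ) → ∑ (xs ++ ys) f ≡ ∑ xs f + ∑ ys f
∑-++ xs ys f = trans (cong sum (map-++ f xs ys)) (sum-++ (map f xs) (map f ys))

∑-cartesianProductWith : ∀ (g : ℕ → ℕ → ℕ) xs ys f →
  ∑ (cartesianProductWith g xs ys) f ≡ ∑[ x ∈ xs ] ∑[ y ∈ ys ] f (g x y)
∑-cartesianProductWith g []       ys f = refl
∑-cartesianProductWith g (x ∷ xs) ys f =
  trans (∑-++ (map (g x) ys) (cartesianProductWith g xs ys) f)
        (cong₂ _+_ (∑-map (g x) ys f) (∑-cartesianProductWith g xs ys f))

∑-↭ : xs ↭ ys → (f : ℕ → ℕ) → ∑ xs f ≡ ∑ ys f
∑-↭ xs↭ys f = sum-↭ (↭.map⁺ f xs↭ys)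

unique-mapOn⁺ : ∀ {A B : Set} {f : A → B} {xs} → Unique xs →
  (∀ {x y} → x ∈ xs → y ∈ xs → f x ≡ f y → x ≡ y) → Unique (map f xs)
unique-mapOn⁺ []           _   = []
unique-mapOn⁺ (x∉ ∷ uniq) inj =
  All.map⁺ (All.tabulate λ y∈ fx≡fy → All.lookup x∉ y∈ (inj (here refl) (there y∈) fx≡fy))
  ∷ unique-mapOn⁺ uniq (λ x∈ y∈ → inj (there x∈) (there y∈))

unique-cartesianProductWith⁺ : ∀ {A B C : Set} (f : A → B → C) {xs ys} → Unique xs → Unique ys →
  (∀ {x₁ x₂ y₁ y₂} → x₁ ∈ xs → x₂ ∈ xs → y₁ ∈ ys → y₂ ∈ ys → f x₁ y₁ ≡ f x₂ y₂ → x₁ ≡ x₂ × y₁ ≡ y₂) →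
  Unique (cartesianProductWith f xs ys)
unique-cartesianProductWith⁺ f []                    _       _   = []
unique-cartesianProductWith⁺ f {x ∷ xs} {ys} (x∉ ∷ uniq-xs) uniq-ys inj =
  Unique.++⁺ (unique-mapOn⁺ uniq-ys (λ y₁∈ y₂∈ → proj₂ ∘ inj (here refl) (here refl) y₁∈ y₂∈))
             (unique-cartesianProductWith⁺ f uniq-xs uniq-ys (λ x₁∈ x₂∈ → inj (there x₁∈) (there x₂∈)))
             disjoint
  where
  disjoint : ∀ {z} → ¬ (z ∈ map (f x) ys × z ∈ cartesianProductWith f xs ys)
  disjoint (z∈ , z∈′) with ∈-map⁻ (f x) z∈ | ∈-cartesianProductWith⁻ f xs ys z∈′
  ... | y , y∈ , refl | x′ , y′ , x′∈ , y′∈ , eq =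
    All.lookup x∉ x′∈ (proj₁ (inj (here refl) (there x′∈) y∈ y′∈ eq))

length-cartesianProductWith : ∀ {A B C : Set} (f : A → B → C) xs ys →
  length (cartesianProductWith f xs ys) ≡ length xs * length ys
length-cartesianProductWith f []       ys = refl
length-cartesianProductWith f (x ∷ xs) ys =
  trans (length-++ (map (f x) ys)) (cong₂ _+_ (length-map (f x) ys) (length-cartesianProductWith f xs ys))

pairSum-+ : ∀ (f g : ℕ → ℕ → ℕ) xs →
  pairSum (λ x y → f x y + g x y) xs ≡ pairSum f xs + pairSum g xs
pairSum-+ f g []       = refl
pairSum-+ f g (x ∷ xs) =
  trans (cong₂ _+_ (∑-+ xs (f x) (g x)) (pairSum-+ f g xs))
        (interchange (∑ xs (f x)) (∑ xs (g x)) (pairSum f xs) (pairSum g xs))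

pairSum-cong : ∀ xs → Unique xs → {f g : ℕ → ℕ → ℕ} →
  (∀ {x y} → x ≢ y → f x y ≡ g x y) → pairSum f xs ≡ pairSum g xs
pairSum-cong []       []          eq = refl
pairSum-cong (x ∷ xs) (x∉ ∷ uniq) eq =
  cong₂ _+_ (∑-cong xs (λ y∈ → eq (All.lookup x∉ y∈))) (pairSum-cong xs uniq eq)

pairSum-two : ∀ xs → pairSum (λ _ _ → 2) xs ≡ length xs * (length xs ∸ 1)
pairSum-two []       = refl
pairSum-two (x ∷ xs) =
  trans (cong₂ _+_ (∑-const xs 2) (pairSum-two xs)) (n*2+n*[n∸1]≡[1+n]*n (length xs))
  where
  n*2+n*[n∸1]≡[1+n]*n : ∀ n → n * 2 + n * (n ∸ 1) ≡ suc n * n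
  n*2+n*[n∸1]≡[1+n]*n zero    = refl
  n*2+n*[n∸1]≡[1+n]*n (suc n) = polynomial n
    where
    polynomial : ∀ n → suc n * 2 + suc n * n ≡ suc (suc n) * suc n
    polynomial = solve-∀

∑∑-pairSum : ∀ (f : ℕ → ℕ → ℕ) → (∀ x y → f x y ≡ f y x) → ∀ xs →
  ∑[ x ∈ xs ] ∑[ y ∈ xs ] f x y ≡ 2 * pairSum f xs + ∑[ x ∈ xs ] f x x
∑∑-pairSum f f-sym []       = refl
∑∑-pairSum f f-sym (x ∷ xs) = begin
  f x x + s + ∑[ z ∈ xs ] (f z x + ∑[ y ∈ xs ] f z y)
    ≡⟨ cong (f x x + s +_) (∑-+ xs (λ z → f z x) (λ z → ∑[ y ∈ xs ] f z y)) ⟩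
  f x x + s + (∑[ z ∈ xs ] f z x + ∑[ z ∈ xs ] ∑[ y ∈ xs ] f z y)
    ≡⟨ cong₂ (λ t u → f x x + s + (t + u)) (∑-cong xs (λ {z} _ → f-sym z x)) (∑∑-pairSum f f-sym xs) ⟩
  f x x + s + (s + (2 * pairSum f xs + d))
    ≡⟨ rearrange (f x x) s (pairSum f xs) d ⟩
  2 * (s + pairSum f xs) + (f x x + d) ∎
  where
  open ≡-Reasoning
  s d : ℕ
  s = ∑[ y ∈ xs ] f x y
  d = ∑[ z ∈ xs ] f z z
  rearrange : ∀ a s P d → a + s + (s + (2 * P + d)) ≡ 2 * (s + P) + (a + d)
  rearrange = solve-∀

-- Indicators and coprimality

indicator : ∀ {ℓ} {P : Set ℓ} → Dec P → ℕ
indicator P? = if does P? then 1 else 0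

module _ {ℓ} {P : Set ℓ} where

  indicator-yes : (P? : Dec P) → P → indicator P? ≡ 1
  indicator-yes (yes _) _  = refl
  indicator-yes (no ¬p) p = contradiction p ¬p

  indicator-no : (P? : Dec P) → ¬ P → indicator P? ≡ 0
  indicator-no (yes p) ¬p = contradiction p ¬p
  indicator-no (no _)  _  = refl

  indicator-⇔ : ∀ {ℓ′} {Q : Set ℓ′} (P? : Dec P) (Q? : Dec Q) → P ⇔ Q → indicator P? ≡ indicator Q?
  indicator-⇔ (yes _) (yes _) _   = refl
  indicator-⇔ (yes p) (no ¬q) P⇔Q = contradiction (Equivalence.to P⇔Q p) ¬q
  indicator-⇔ (no ¬p) (yes q) P⇔Q = contradiction (Equivalence.from P⇔Q q) ¬p
  indicator-⇔ (no _)  (no _)  _   = refl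

  indicator-× : ∀ {ℓ′} {Q : Set ℓ′} (P? : Dec P) (Q? : Dec Q) → indicator (P? ×-dec Q?) ≡ indicator P? * indicator Q?
  indicator-× (yes _) (yes _) = refl
  indicator-× (yes _) (no _)  = refl
  indicator-× (no _)  _       = refl

∑-indicator-≟ : ∀ {a} xs → Unique xs → a ∈ xs → ∑[ x ∈ xs ] indicator (x ≟ a) ≡ 1
∑-indicator-≟ (x ∷ xs) (x∉ ∷ _) (here refl) =
  cong₂ _+_ (indicator-yes (x ≟ x) refl) (∑-zero xs (λ y∈ → indicator-no (_ ≟ x) (≢-sym (All.lookup x∉ y∈))))
∑-indicator-≟ (x ∷ xs) (x∉ ∷ uniq) (there a∈) =
  cong₂ _+_ (indicator-no (x ≟ _) (All.lookup x∉ a∈)) (∑-indicator-≟ xs uniq a∈)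

coprime-divisors : Coprime a b → ∀ {u v} → u ∣ a → v ∣ b → Coprime u v
coprime-divisors a⊥b u∣a v∣b (d∣u , d∣v) = a⊥b (∣-trans d∣u u∣a , ∣-trans d∣v v∣b)

coprime-* : ∀ {m n o} → Coprime m n → Coprime m o → Coprime m (n * o)
coprime-* m⊥n m⊥o (d∣m , d∣n*o) = m⊥o (d∣m , coprime-divisor (coprime-divisors m⊥n d∣m ∣-refl) d∣n*o)

coprime-^ : ∀ {m n} k → Coprime m n → Coprime (m ^ k) n
coprime-^ zero    _   = 1-coprimeTo _
coprime-^ (suc k) m⊥n = Coprimality.sym (coprime-* (Coprimality.sym m⊥n) (Coprimality.sym (coprime-^ k m⊥n)))

coprime⇒*-∣ : ∀ {m n o} → Coprime m n → m ∣ o → n ∣ o → m * n ∣ o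
coprime⇒*-∣ {m} {n} m⊥n (divides q refl) n∣q*m =
  subst (m * n ∣_) (*-comm m q)
        (*-monoʳ-∣ m (coprime-divisor (Coprimality.sym m⊥n) (subst (n ∣_) (*-comm q m) n∣q*m)))

prime∤⇒coprime : Prime p → ¬ p ∣ n → Coprime p n
prime∤⇒coprime p-prime p∤n (d∣p , d∣n) with prime⇒irreducible p-prime d∣p
... | inj₁ d≡1 = d≡1
... | inj₂ refl = contradiction d∣n p∤n

prime≢1 : Prime p → p ≢ 1
prime≢1 p-prime = nonTrivial⇒≢1 {{prime⇒nonTrivial p-prime}}

coprime-*⇔ : Coprime a b → ∀ {u₁ u₂ v₁ v₂} → u₁ ∣ a → u₂ ∣ a → v₁ ∣ b → v₂ ∣ b →
  Coprime (u₁ * v₁) (u₂ * v₂) ⇔ (Coprime u₁ u₂ × Coprime v₁ v₂)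
coprime-*⇔ a⊥b {u₁} {u₂} {v₁} {v₂} u₁∣a u₂∣a v₁∣b v₂∣b = mk⇔ split join
  where
  split : Coprime (u₁ * v₁) (u₂ * v₂) → Coprime u₁ u₂ × Coprime v₁ v₂
  split uv⊥uv = coprime-divisors uv⊥uv (m∣m*n v₁) (m∣m*n v₂) , coprime-divisors uv⊥uv (n∣m*n u₁) (n∣m*n u₂)
  join : Coprime u₁ u₂ × Coprime v₁ v₂ → Coprime (u₁ * v₁) (u₂ * v₂)
  join (u₁⊥u₂ , v₁⊥v₂) = coprime-*
    (Coprimality.sym (coprime-* (Coprimality.sym u₁⊥u₂) (coprime-divisors a⊥b u₂∣a v₁∣b)))
    (Coprimality.sym (coprime-* (Coprimality.sym (coprime-divisors a⊥b u₁∣a v₂∣b)) (Coprimality.sym v₁⊥v₂)))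

gcd[u*v,a]≡u : Coprime a b → ∀ {u v} → u ∣ a → v ∣ b → gcd (u * v) a ≡ u
gcd[u*v,a]≡u {a} a⊥b {u} {v} u∣a v∣b = ∣-antisym
  (coprime-divisor (coprime-divisors a⊥b (gcd[m,n]∣n (u * v) a) v∣b)
                   (subst (gcd (u * v) a ∣_) (*-comm u v) (gcd[m,n]∣m (u * v) a)))
  (gcd-greatest (m∣m*n v) u∣a)

∣*⇒∣*gcd : ∀ {z} c m → z ∣ c * m → z ∣ c * gcd z m
∣*⇒∣*gcd {z} c m z∣c*m = subst (z ∣_) (sym (c*gcd[m,n]≡gcd[cm,cn] c z m)) (gcd-greatest (n∣m*n c) z∣c*m)

∣*-coprime⇒≡gcd*gcd : Coprime a b → ∀ {z} → z ∣ a * b → z ≡ gcd z a * gcd z b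
∣*-coprime⇒≡gcd*gcd {a} {b} a⊥b {z} z∣a*b = ∣-antisym
  (∣*⇒∣*gcd (gcd z a) b (subst (z ∣_) (*-comm b (gcd z a)) (∣*⇒∣*gcd b a (subst (z ∣_) (*-comm a b) z∣a*b))))
  (coprime⇒*-∣ (coprime-divisors a⊥b (gcd[m,n]∣n z a) (gcd[m,n]∣n z b)) (gcd[m,n]∣m z a) (gcd[m,n]∣m z b))

∣p^k∧p∤⇒≡1 : Prime p → ∀ k {d} → d ∣ p ^ k → ¬ p ∣ d → d ≡ 1
∣p^k∧p∤⇒≡1 p-prime k d∣p^k p∤d = coprime-^ k (prime∤⇒coprime p-prime p∤d) (d∣p^k , ∣-refl)

prime∣prime^⇒≡ : ∀ {q} → Prime p → Prime q → ∀ j → p ∣ q ^ j → p ≡ q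
prime∣prime^⇒≡ {p} {q} p-prime q-prime j p∣q^j with p ∣? q
... | no p∤q = contradiction
      (Coprimality.sym (coprime-^ j (Coprimality.sym (prime∤⇒coprime p-prime p∤q))) (∣-refl , p∣q^j))
      (prime≢1 p-prime)
... | yes p∣q with prime⇒irreducible q-prime p∣q
...   | inj₁ p≡1 = contradiction p≡1 (prime≢1 p-prime)
...   | inj₂ p≡q = p≡q

coprime-self⇔≡1 : Coprime n n ⇔ n ≡ 1
coprime-self⇔≡1 = mk⇔ (λ n⊥n → n⊥n (∣-refl , ∣-refl)) (λ { refl → 1-coprimeTo 1 })

coprimeIndicator : ℕ → ℕ → ℕ
coprimeIndicator x y = indicator (coprime? x y)

coprimeIndicator-sym : ∀ x y → coprimeIndicator x y ≡ coprimeIndicator y x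
coprimeIndicator-sym x y = indicator-⇔ (coprime? x y) (coprime? y x) (mk⇔ Coprimality.sym Coprimality.sym)

coprimeIndicator-self : ∀ x → coprimeIndicator x x ≡ indicator (x ≟ 1)
coprimeIndicator-self x = indicator-⇔ (coprime? x x) (x ≟ 1) coprime-self⇔≡1

coprimeIndicator-1ˡ : ∀ y → coprimeIndicator 1 y ≡ 1
coprimeIndicator-1ˡ y = indicator-yes (coprime? 1 y) (1-coprimeTo y)

coprimeIndicator-1ʳ : ∀ x → coprimeIndicator x 1 ≡ 1
coprimeIndicator-1ʳ x = indicator-yes (coprime? x 1) (Coprimality.sym (1-coprimeTo x))

coprimeIndicator-* : Coprime a b → ∀ {u₁ u₂ v₁ v₂} → u₁ ∣ a → u₂ ∣ a → v₁ ∣ b → v₂ ∣ b →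
  coprimeIndicator (u₁ * v₁) (u₂ * v₂) ≡ coprimeIndicator u₁ u₂ * coprimeIndicator v₁ v₂
coprimeIndicator-* a⊥b {u₁} {u₂} {v₁} {v₂} u₁∣a u₂∣a v₁∣b v₂∣b =
  trans (indicator-⇔ (coprime? _ _) (coprime? u₁ u₂ ×-dec coprime? v₁ v₂) (coprime-*⇔ a⊥b u₁∣a u₂∣a v₁∣b v₂∣b))
        (indicator-× (coprime? u₁ u₂) (coprime? v₁ v₂))

-- Counting coprime pairs

coprimePairs : List ℕ → ℕ
coprimePairs xs = ∑[ x ∈ xs ] ∑[ y ∈ xs ] coprimeIndicator x y

coprimePairs-↭ : xs ↭ ys → coprimePairs xs ≡ coprimePairs ys
coprimePairs-↭ {xs} {ys} xs↭ys =
  trans (∑-cong xs (λ {x} _ → ∑-↭ xs↭ys (coprimeIndicator x))) (∑-↭ xs↭ys (λ x → ∑ ys (coprimeIndicator x)))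

coprimePairs-1∷ : ∀ xs → coprimePairs (1 ∷ xs) ≡ 1 + 2 * length xs + coprimePairs xs
coprimePairs-1∷ xs = begin
  coprimeIndicator 1 1 + ∑ xs (coprimeIndicator 1)
    + ∑[ x ∈ xs ] (coprimeIndicator x 1 + ∑ xs (coprimeIndicator x))
    ≡⟨ cong (coprimeIndicator 1 1 + ∑ xs (coprimeIndicator 1) +_) (∑-+ xs (λ x → coprimeIndicator x 1) _) ⟩
  coprimeIndicator 1 1 + ∑ xs (coprimeIndicator 1)
    + (∑[ x ∈ xs ] coprimeIndicator x 1 + coprimePairs xs)
    ≡⟨ cong₂ (λ s t → 1 + s + (t + coprimePairs xs)) (ones coprimeIndicator-1ˡ) (ones coprimeIndicator-1ʳ) ⟩
  1 + length xs + (length xs + coprimePairs xs)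
    ≡⟨ rearrange (length xs) (coprimePairs xs) ⟩
  1 + 2 * length xs + coprimePairs xs ∎
  where
  open ≡-Reasoning
  ones : {f : ℕ → ℕ} → (∀ x → f x ≡ 1) → ∑ xs f ≡ length xs
  ones f≡1 = trans (∑-cong xs (λ {x} _ → f≡1 x)) (trans (∑-const xs 1) (*-identityʳ (length xs)))
  rearrange : ∀ l c → 1 + l + (l + c) ≡ 1 + 2 * l + c
  rearrange = solve-∀

coprimePairs-common-factor : p ≢ 1 → (∀ {x} → x ∈ xs → p ∣ x) → coprimePairs xs ≡ 0
coprimePairs-common-factor {xs = xs} p≢1 p∣ = ∑-zero xs λ x∈ → ∑-zero xs λ y∈ →
  indicator-no (coprime? _ _) (λ x⊥y → p≢1 (x⊥y (p∣ x∈ , p∣ y∈)))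

coprimePairs-cartesianProduct : Coprime a b → (∀ {u} → u ∈ xs → u ∣ a) → (∀ {v} → v ∈ ys → v ∣ b) →
  coprimePairs (cartesianProductWith _*_ xs ys) ≡ coprimePairs xs * coprimePairs ys
coprimePairs-cartesianProduct {xs = xs} {ys = ys} a⊥b ∣a ∣b = begin
  ∑[ z ∈ xs⊗ys ] ∑[ w ∈ xs⊗ys ] coprimeIndicator z w
    ≡⟨ ∑-cartesianProductWith _*_ xs ys _ ⟩
  ∑[ u ∈ xs ] ∑[ v ∈ ys ] ∑[ w ∈ xs⊗ys ] coprimeIndicator (u * v) w
    ≡⟨ ∑-cong xs (λ u∈ → ∑-cong ys (λ v∈ → row u∈ v∈)) ⟩
  ∑[ u ∈ xs ] ∑[ v ∈ ys ] (∑ xs (coprimeIndicator u) * ∑ ys (coprimeIndicator v))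
    ≡⟨ ∑∑-separable xs ys _ _ ⟩
  coprimePairs xs * coprimePairs ys ∎
  where
  open ≡-Reasoning
  xs⊗ys : List ℕ
  xs⊗ys = cartesianProductWith _*_ xs ys
  row : ∀ {u v} → u ∈ xs → v ∈ ys →
    ∑[ w ∈ xs⊗ys ] coprimeIndicator (u * v) w ≡ ∑ xs (coprimeIndicator u) * ∑ ys (coprimeIndicator v)
  row u∈ v∈ = trans (∑-cartesianProductWith _*_ xs ys _)
    (trans (∑-cong xs λ u′∈ → ∑-cong ys λ v′∈ → coprimeIndicator-* a⊥b (∣a u∈) (∣a u′∈) (∣b v∈) (∣b v′∈))
           (∑∑-separable xs ys _ _))

-- Divisor lists

record IsDivisorList (n : ℕ) (xs : List ℕ) : Set where
  field
    unique : Unique xs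
    ∈⇒∣    : ∀ {d} → d ∈ xs → d ∣ n
    ∣⇒∈    : ∀ {d} → d ∣ n → d ∈ xs
open IsDivisorList

isDivisorList-↭ : IsDivisorList n xs → IsDivisorList n ys → xs ↭ ys
isDivisorList-↭ xs-div ys-div = ∼bag⇒↭ (unique∧set⇒bag (unique xs-div) (unique ys-div)
  (mk⇔ (∣⇒∈ ys-div ∘ ∈⇒∣ xs-div) (∣⇒∈ xs-div ∘ ∈⇒∣ ys-div)))

isDivisorList-divisors : ∀ n → .{{NonZero n}} → IsDivisorList n (divisors n)
isDivisorList-divisors n = record
  { unique = Unique.filter⁺ (_∣? n) (Unique.map⁺ suc-injective (Unique.upTo⁺ n))
  ; ∈⇒∣    = λ d∈ → proj₂ (∈-filter⁻ (_∣? n) {xs = map suc (upTo n)} d∈)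
  ; ∣⇒∈    = λ d∣n → ∈-filter⁺ (_∣? n) (∈-1…n d∣n) d∣n
  }
  where
  ∈-1…n : ∀ {d} → d ∣ n → d ∈ map suc (upTo n)
  ∈-1…n {zero}  0∣n = contradiction (0∣⇒≡0 0∣n) (≢-nonZero⁻¹ n)
  ∈-1…n {suc d} d∣n = ∈-map⁺ suc (∈-upTo⁺ (∣⇒≤ d∣n))

powers : ℕ → ℕ → List ℕ
powers p zero    = 1 ∷ []
powers p (suc k) = 1 ∷ map (p *_) (powers p k)

length-powers : ∀ p k → length (powers p k) ≡ suc k
length-powers p zero    = refl
length-powers p (suc k) = cong suc (trans (length-map (p *_) (powers p k)) (length-powers p k))

coprimePairs-powers : Prime p → ∀ k → coprimePairs (powers p k) ≡ 1 + 2 * k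
coprimePairs-powers _ zero = coprimePairs-1∷ []
coprimePairs-powers {p} p-prime (suc k) = begin
  coprimePairs (1 ∷ multiples)
    ≡⟨ coprimePairs-1∷ multiples ⟩
  1 + 2 * length multiples + coprimePairs multiples
    ≡⟨ cong₂ (λ l c → 1 + 2 * l + c) (trans (length-map (p *_) (powers p k)) (length-powers p k))
             (coprimePairs-common-factor (prime≢1 p-prime) p∣) ⟩
  1 + 2 * suc k + 0
    ≡⟨ +-identityʳ _ ⟩
  1 + 2 * suc k ∎
  where
  open ≡-Reasoning
  multiples : List ℕ
  multiples = map (p *_) (powers p k)
  p∣ : ∀ {x} → x ∈ multiples → p ∣ x
  p∣ x∈ with ∈-map⁻ (p *_) x∈
  ... | y , _ , refl = m∣m*n y

isDivisorList-powers : Prime p → ∀ k → IsDivisorList (p ^ k) (powers p k)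
isDivisorList-powers {p} p-prime k = record { unique = unique-powers k ; ∈⇒∣ = ∈⇒∣p^ k ; ∣⇒∈ = ∣p^⇒∈ k }
  where
  instance
    p≢0 : NonZero p
    p≢0 = prime⇒nonZero p-prime

  unique-powers : ∀ k → Unique (powers p k)
  unique-powers zero    = [] ∷ []
  unique-powers (suc k) = All.tabulate 1≢ ∷ Unique.map⁺ (*-cancelˡ-≡ _ _ p) (unique-powers k)
    where
    1≢ : ∀ {x} → x ∈ map (p *_) (powers p k) → 1 ≢ x
    1≢ x∈ 1≡x with ∈-map⁻ (p *_) x∈
    ... | y , _ , refl = prime≢1 p-prime (m*n≡1⇒m≡1 p y (sym 1≡x))

  ∈⇒∣p^ : ∀ k {d} → d ∈ powers p k → d ∣ p ^ k
  ∈⇒∣p^ zero    (here refl) = ∣-refl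
  ∈⇒∣p^ (suc k) (here refl) = 1∣ _
  ∈⇒∣p^ (suc k) (there d∈) with ∈-map⁻ (p *_) d∈
  ... | y , y∈ , refl = *-monoʳ-∣ p (∈⇒∣p^ k y∈)

  ∣p^⇒∈ : ∀ k {d} → d ∣ p ^ k → d ∈ powers p k
  ∣p^⇒∈ zero    d∣1 = here (∣1⇒≡1 d∣1)
  ∣p^⇒∈ (suc k) {d} d∣p^k with p ∣? d
  ... | no p∤d = here (∣p^k∧p∤⇒≡1 p-prime (suc k) d∣p^k p∤d)
  ... | yes (divides q refl) = subst (_∈ powers p (suc k)) (*-comm p q)
        (there (∈-map⁺ (p *_) (∣p^⇒∈ k (*-cancelˡ-∣ p (subst (_∣ p ^ suc k) (*-comm q p) d∣p^k)))))

isDivisorList-* : Coprime a b → IsDivisorList a xs → IsDivisorList b ys →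
  IsDivisorList (a * b) (cartesianProductWith _*_ xs ys)
isDivisorList-* {a} {b} {xs} {ys} a⊥b xs-div ys-div = record
  { unique = unique-cartesianProductWith⁺ _*_ (unique xs-div) (unique ys-div) λ u₁∈ u₂∈ v₁∈ v₂∈ eq →
      trans (sym (gcd-a u₁∈ v₁∈)) (trans (cong (λ z → gcd z a) eq) (gcd-a u₂∈ v₂∈)) ,
      trans (sym (gcd-b u₁∈ v₁∈)) (trans (cong (λ z → gcd z b) eq) (gcd-b u₂∈ v₂∈))
  ; ∈⇒∣ = ∈⇒∣ab
  ; ∣⇒∈ = λ {z} z∣ab → subst (_∈ cartesianProductWith _*_ xs ys) (sym (∣*-coprime⇒≡gcd*gcd a⊥b z∣ab))
      (∈-cartesianProductWith⁺ _*_ (∣⇒∈ xs-div (gcd[m,n]∣n z a)) (∣⇒∈ ys-div (gcd[m,n]∣n z b)))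
  }
  where
  gcd-a : ∀ {u v} → u ∈ xs → v ∈ ys → gcd (u * v) a ≡ u
  gcd-a u∈ v∈ = gcd[u*v,a]≡u a⊥b (∈⇒∣ xs-div u∈) (∈⇒∣ ys-div v∈)
  gcd-b : ∀ {u v} → u ∈ xs → v ∈ ys → gcd (u * v) b ≡ v
  gcd-b {u} {v} u∈ v∈ = trans (cong (λ z → gcd z b) (*-comm u v))
    (gcd[u*v,a]≡u (Coprimality.sym a⊥b) (∈⇒∣ ys-div v∈) (∈⇒∣ xs-div u∈))
  ∈⇒∣ab : ∀ {z} → z ∈ cartesianProductWith _*_ xs ys → z ∣ a * b
  ∈⇒∣ab z∈ with ∈-cartesianProductWith⁻ _*_ xs ys z∈
  ... | u , v , u∈ , v∈ , refl = *-pres-∣ (∈⇒∣ xs-div u∈) (∈⇒∣ ys-div v∈)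

primePowerProduct : List (ℕ × ℕ) → ℕ
primePowerProduct fs = product (map (λ pk → proj₁ pk ^ proj₂ pk) fs)

divisorList : List (ℕ × ℕ) → List ℕ
divisorList []             = 1 ∷ []
divisorList ((p , k) ∷ fs) = cartesianProductWith _*_ (powers p k) (divisorList fs)

length-divisorList : ∀ fs → length (divisorList fs) ≡ product (map (λ pk → suc (proj₂ pk)) fs)
length-divisorList []             = refl
length-divisorList ((p , k) ∷ fs) =
  trans (length-cartesianProductWith _*_ (powers p k) (divisorList fs))
        (cong₂ _*_ (length-powers p k) (length-divisorList fs))

AllPrime : List (ℕ × ℕ) → Set
AllPrime = All (λ pk → Prime (proj₁ pk))

prime∤primePowerProduct : ∀ fs → Prime p → AllPrime fs → All (λ qk → p ≢ proj₁ qk) fs →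
  ¬ p ∣ primePowerProduct fs
prime∤primePowerProduct []             p-prime _ _ p∣1 = prime≢1 p-prime (∣1⇒≡1 p∣1)
prime∤primePowerProduct ((q , j) ∷ fs) p-prime (q-prime ∷ primes) (p≢q ∷ p≢) p∣
  with euclidsLemma (q ^ j) (primePowerProduct fs) p-prime p∣
... | inj₁ p∣q^j  = p≢q (prime∣prime^⇒≡ p-prime q-prime j p∣q^j)
... | inj₂ p∣rest = prime∤primePowerProduct fs p-prime primes p≢ p∣rest

coprime-primePowerProduct : ∀ {k} fs → AllPrime ((p , k) ∷ fs) → Unique (map proj₁ ((p , k) ∷ fs)) →
  Coprime (p ^ k) (primePowerProduct fs)
coprime-primePowerProduct {k = k} fs (p-prime ∷ primes) (p∉ ∷ _) =
  coprime-^ k (prime∤⇒coprime p-prime (prime∤primePowerProduct fs p-prime primes (All.map⁻ p∉)))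

primePowerProduct≢0 : ∀ fs → AllPrime fs → NonZero (primePowerProduct fs)
primePowerProduct≢0 fs primes =
  product≢0 (All.map⁺ (All.map (λ {pk} p-prime → m^n≢0 (proj₁ pk) (proj₂ pk) {{prime⇒nonZero p-prime}}) primes))

isDivisorList-divisorList : ∀ fs → AllPrime fs → Unique (map proj₁ fs) →
  IsDivisorList (primePowerProduct fs) (divisorList fs)
isDivisorList-divisorList [] _ _ = record
  { unique = [] ∷ [] ; ∈⇒∣ = λ { (here refl) → ∣-refl } ; ∣⇒∈ = here ∘ ∣1⇒≡1 }
isDivisorList-divisorList ((p , k) ∷ fs) primes@(p-prime ∷ primes′) uniq@(_ ∷ uniq′) =
  isDivisorList-* (coprime-primePowerProduct fs primes uniq)
    (isDivisorList-powers p-prime k) (isDivisorList-divisorList fs primes′ uniq′)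

coprimePairs-divisorList : ∀ fs → AllPrime fs → Unique (map proj₁ fs) →
  coprimePairs (divisorList fs) ≡ product (map (λ pk → suc (2 * proj₂ pk)) fs)
coprimePairs-divisorList [] _ _ = coprimePairs-1∷ []
coprimePairs-divisorList ((p , k) ∷ fs) primes@(p-prime ∷ primes′) uniq@(_ ∷ uniq′) =
  trans (coprimePairs-cartesianProduct (coprime-primePowerProduct fs primes uniq)
          (∈⇒∣ (isDivisorList-powers p-prime k)) (∈⇒∣ (isDivisorList-divisorList fs primes′ uniq′)))
        (cong₂ _*_ (coprimePairs-powers p-prime k) (coprimePairs-divisorList fs primes′ uniq′))

-- Distances in the divisor prime graph

distanceFrom : ∀ {x y} → Dec (x ≡ y) → Dec (Coprime x y) → ℕ
distanceFrom (yes _) _       = 0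
distanceFrom (no _)  (yes _) = 1
distanceFrom (no _)  (no _)  = 2

distance : ℕ → ℕ → ℕ
distance x y = distanceFrom (x ≟ y) (coprime? x y)

distance+coprimeIndicator≡2 : ∀ {x y} → x ≢ y → distance x y + coprimeIndicator x y ≡ 2
distance+coprimeIndicator≡2 {x} {y} x≢y = from-decisions (x ≟ y) (coprime? x y)
  where
  from-decisions : (x≟y : Dec (x ≡ y)) (x⊥?y : Dec (Coprime x y)) → distanceFrom x≟y x⊥?y + indicator x⊥?y ≡ 2
  from-decisions (yes x≡y) _       = contradiction x≡y x≢y
  from-decisions (no _)    (yes _) = refl
  from-decisions (no _)    (no _)  = refl

pairSum-distance : Unique xs → 1 ∈ xs →
  pairSum distance xs ≡ length xs * (length xs ∸ 1) ∸ (coprimePairs xs ∸ 1) / 2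
pairSum-distance {xs} uniq 1∈ = begin
  W
    ≡⟨ m+n∸n≡m W P ⟨
  W + P ∸ P
    ≡⟨ cong₂ _∸_ W+P≡D*[D∸1] (sym (m*n/n≡m P 2)) ⟩
  D * (D ∸ 1) ∸ P * 2 / 2
    ≡⟨ cong (λ c → D * (D ∸ 1) ∸ c / 2) (trans (*-comm P 2) (sym (m+n∸n≡m (2 * P) 1))) ⟩
  D * (D ∸ 1) ∸ (2 * P + 1 ∸ 1) / 2
    ≡⟨ cong (λ c → D * (D ∸ 1) ∸ (c ∸ 1) / 2) C≡2P+1 ⟨
  D * (D ∸ 1) ∸ (coprimePairs xs ∸ 1) / 2 ∎
  where
  open ≡-Reasoning
  W P D : ℕ
  W = pairSum distance xs
  P = pairSum coprimeIndicator xs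
  D = length xs
  W+P≡D*[D∸1] : W + P ≡ D * (D ∸ 1)
  W+P≡D*[D∸1] = trans (sym (pairSum-+ distance coprimeIndicator xs))
                      (trans (pairSum-cong xs uniq distance+coprimeIndicator≡2) (pairSum-two xs))
  C≡2P+1 : coprimePairs xs ≡ 2 * P + 1
  C≡2P+1 = trans (∑∑-pairSum coprimeIndicator coprimeIndicator-sym xs)
                 (cong (2 * P +_) (trans (∑-cong xs (λ {x} _ → coprimeIndicator-self x)) (∑-indicator-≟ xs uniq 1∈)))

walk-length≥1 : ∀ {n x y ℓ} → x ≢ y → Walk n x y ℓ → 1 ≤ ℓ
walk-length≥1 x≢y (nil _)    = contradiction refl x≢y
walk-length≥1 x≢y (cons _ _) = s≤s z≤n

walk-length≥2 : ∀ {n x y ℓ} → x ≢ y → ¬ Coprime x y → Walk n x y ℓ → 2 ≤ ℓ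
walk-length≥2 x≢y _   (nil _)                            = contradiction refl x≢y
walk-length≥2 _   x∤y (cons (_ , _ , _ , gcd≡1) (nil _)) = ⊥-elim (x∤y (gcd≡1⇒coprime gcd≡1))
walk-length≥2 _   _   (cons _ (cons _ _))                = s≤s (s≤s z≤n)

divisor⇒vertex : .{{NonZero n}} → ∀ {x} → x ∣ n → Vertex n x
divisor⇒vertex {n} {zero}  0∣n = contradiction (0∣⇒≡0 0∣n) (≢-nonZero⁻¹ n)
divisor⇒vertex {n} {suc x} x∣n = s≤s z≤n , x∣n

distance-isDist : .{{NonZero n}} → ∀ {x y} → x ∣ n → y ∣ n → IsDist n x y (distance x y)
distance-isDist {n} {x} {y} x∣n y∣n = from-decisions (x ≟ y) (coprime? x y)
  where
  vx : Vertex n x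
  vx = divisor⇒vertex x∣n
  vy : Vertex n y
  vy = divisor⇒vertex y∣n
  v1 : Vertex n 1
  v1 = divisor⇒vertex (1∣ n)
  from-decisions : (x≟y : Dec (x ≡ y)) (x⊥?y : Dec (Coprime x y)) → IsDist n x y (distanceFrom x≟y x⊥?y)
  from-decisions (yes refl) _         = nil vx , λ _ _ → z≤n
  from-decisions (no x≢y)   (yes x⊥y) =
    cons (vx , vy , x≢y , coprime⇒gcd≡1 x⊥y) (nil vy) , λ _ → walk-length≥1 x≢y
  from-decisions (no x≢y)   (no x∤y)  =
    cons (vx , v1 , x≢1 , gcd-zeroʳ x) (cons (v1 , vy , 1≢y , gcd-zeroˡ y) (nil vy)) ,
    λ _ → walk-length≥2 {x = x} {y = y} x≢y x∤y
    where
    x≢1 : x ≢ 1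
    x≢1 refl = x∤y (1-coprimeTo y)
    1≢y : 1 ≢ y
    1≢y refl = x∤y (Coprimality.sym (1-coprimeTo x))

theorem3p1 : (n : ℕ) (fs : List (ℕ × ℕ))
    → All (λ pk → Prime (proj₁ pk)) fs
    → All (λ pk → 1 ≤ proj₂ pk) fs
    → Unique (map proj₁ fs)
    → n ≡ product (map (λ pk → proj₁ pk ^ proj₂ pk) fs)
    → Σ (ℕ → ℕ → ℕ) λ dist
      → (∀ x y → x ∣ n → y ∣ n → IsDist n x y (dist x y))
      × (wiener n dist
          ≡ product (map (λ pk → suc (proj₂ pk)) fs) * (product (map (λ pk → suc (proj₂ pk)) fs) ∸ 1)
            ∸ (product (map (λ pk → suc (2 * proj₂ pk)) fs) ∸ 1) / 2)
theorem3p1 _ fs primes _ uniq refl = distance , (λ _ _ → distance-isDist) , (begin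
  pairSum distance (divisors N)
    ≡⟨ pairSum-distance (unique divisors-N) (∣⇒∈ divisors-N (1∣ N)) ⟩
  length (divisors N) * (length (divisors N) ∸ 1) ∸ (coprimePairs (divisors N) ∸ 1) / 2
    ≡⟨ cong₂ (λ d c → d * (d ∸ 1) ∸ (c ∸ 1) / 2)
         (trans (↭-length divisors↭) (length-divisorList fs))
         (trans (coprimePairs-↭ divisors↭) (coprimePairs-divisorList fs primes uniq)) ⟩
  _ ∎)
  where
  open ≡-Reasoning
  N : ℕ
  N = primePowerProduct fs
  instance
    N≢0 : NonZero N
    N≢0 = primePowerProduct≢0 fs primes
  divisors-N : IsDivisorList N (divisors N)
  divisors-N = isDivisorList-divisors N
  divisors↭ : divisors N ↭ divisorList fs
  divisors↭ = isDivisorList-↭ divisors-N (isDivisorList-divisorList fs primes uniq)
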